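{- A proper interval graph $G$ has a $[\lambda,C]$-partition if and only if $G$ has a $[\lambda,C]$-block partition.
   Context: A proper interval graph is given by an interval representation $\{I_v\}$ (intervals on the real line, none properly containing another; distinct vertices adjacent iff intervals intersect). The canonical ordering orders vertices by left endpoint of their intervals, ties broken by right endpoint (smaller first). A block is a set of vertices that are consecutive in the canonical ordering. A $[\lambda,C]$-partition of $G=(V,E)$ is a partition $\{P_1,\dots,P_t\}$ of $V$ such that each $G[P_i]$ is connected, each $|P_i|\le C$, and every clique of $G$ intersects at most $\lambda$ parts. A $[\lambda,C]$-block partition is a $[\lambda,C]$-partition in which every part is a block. -}

module Defs where

open import Level using (Level; _⊔_)
open import Data.Nat using (ℕ; _≤_)
open import Data.Fin using (Fin; _≟_) renaming (_≤_ to _≤ᶠ_; _<_ to _<ᶠ_)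
open import Data.Fin.Properties using (any?)
open import Data.Fin.Subset using (Subset; _∈_)
open import Data.Fin.Subset.Properties using (_∈?_)
open import Data.List using (List; length; filter; allFin)
open import Data.Product using (Σ; ∃; _×_; _,_)
open import Data.Product.Properties using ()
open import Data.Sum using (_⊎_)
open import Relation.Nullary using (¬_; Dec)
open import Relation.Nullary.Decidable using (_×-dec_)
open import Relation.Unary using (Pred; Decidable)
open import Relation.Binary using (Rel)
open import Relation.Binary.PropositionalEquality using (_≡_; _≢_)
open import Function using (Surjective; Injective)

count : ∀ {m p} {P : Pred (Fin m) p} → Decidable P → ℕ
count {m} P? = length (filter P? (allFin m))

-- Endpoints live in an arbitrary strict total order (A, _<_) with
-- propositional equality (e.g. the real line).
module _ {a ℓ : Level} {A : Set a} (_<_ : Rel A ℓ) where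

  _≤A_ : Rel A (a ⊔ ℓ)
  x ≤A y = x < y ⊎ x ≡ y

  -- An interval representation of a proper interval graph on vertices Fin n:
  -- vertex v has the closed interval [L v , R v], and no interval properly
  -- contains another.
  record PIRep (n : ℕ) : Set (a ⊔ ℓ) where
    field
      L R    : Fin n → A
      valid  : ∀ v → L v ≤A R v
      proper : ∀ u v → ¬ (L u ≤A L v × R v ≤A R u × (L u ≢ L v ⊎ R u ≢ R v))

  module _ {n : ℕ} (G : PIRep n) where
    open PIRep G

    Adj : Fin n → Fin n → Set (a ⊔ ℓ)
    Adj u v = u ≢ v × L u ≤A R v × L v ≤A R u

    LexLess : Fin n → Fin n → Set (a ⊔ ℓ)
    LexLess u v = L u < L v ⊎ (L u ≡ L v × R u < R v)

    -- pos is a canonical ordering: a bijection Fin n → positions Fin n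
    -- ordering vertices by left endpoint, ties by right endpoint
    -- (vertices with identical intervals may be ordered arbitrarily).
    CanonicalOrdering : (Fin n → Fin n) → Set (a ⊔ ℓ)
    CanonicalOrdering pos = Injective _≡_ _≡_ pos × (∀ u v → LexLess u v → pos u <ᶠ pos v)

    data PathIn {p} (P : Fin n → Set p) : Fin n → Fin n → Set (a ⊔ ℓ ⊔ p) where
      here  : ∀ {u} → PathIn P u u
      step  : ∀ {u w v} → Adj u w → P w → PathIn P w v → PathIn P u v

    IsClique : Subset n → Set (a ⊔ ℓ)
    IsClique K = ∀ u v → u ∈ K → v ∈ K → u ≢ v → Adj u v

    -- A partition into t (nonempty) parts given by the part-assignment p.
    module _ {t : ℕ} (p : Fin n → Fin t) where

      partSize : Fin t → ℕ
      partSize i = count (λ v → p v ≟ i)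

      partsMet : Subset n → ℕ
      partsMet K = count (λ i → any? (λ v → (v ∈? K) ×-dec (p v ≟ i)))

      record IsPartition (lam C : ℕ) : Set (a ⊔ ℓ) where
        field
          nonempty  : Surjective _≡_ _≡_ p
          connected : ∀ i u v → p u ≡ i → p v ≡ i → PathIn (λ w → p w ≡ i) u v
          bounded   : ∀ i → partSize i ≤ C
          cliques   : ∀ K → IsClique K → partsMet K ≤ lam

      AllBlocks : (Fin n → Fin n) → Set
      AllBlocks pos = ∀ u v w → p u ≡ p w → pos u ≤ᶠ pos v → pos v ≤ᶠ pos w → p v ≡ p u

    HasPartition : ℕ → ℕ → Set (a ⊔ ℓ)
    HasPartition lam C = Σ ℕ λ t → Σ (Fin n → Fin t) λ p → IsPartition p lam C

    HasBlockPartition : (Fin n → Fin n) → ℕ → ℕ → Set (a ⊔ ℓ)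
    HasBlockPartition pos lam C =
      Σ ℕ λ t → Σ (Fin n → Fin t) λ p → IsPartition p lam C × AllBlocks p pos

module Submission where

-- One direction is trivial; for the other we ROUND an arbitrary
-- [λ,C]-partition p into blocks of the canonical ordering.  With M = C!,
-- every vertex v gets the integral weight M / |part of v|, so each part
-- weighs exactly M and each vertex at least M / C.  The vertex v is put into
-- block ⌊prefix(v) / M⌋, where prefix(v) is the weight of the vertices before
-- v.  These labels are monotone, so the classes are blocks, and:
--  * no block is empty, since single weights are at most M;
--  * a block is connected: where consecutive vertices are non-adjacent, the
--    umbrella property forbids any (connected) part to straddle the cut, so
--    the prefix is a multiple of M there and the label jumps;
--  * a block has at most C vertices, since all but its last vertex weigh
--    less than M together;
--  * a clique K meets at most λ blocks: the window of vertices from the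
--    first one reaching the last vertex of K up to that vertex is a clique,
--    and the number of labels met by K is bounded by the number of parts of
--    p meeting the window.

open import Level using (Level; _⊔_)
open import Data.Empty using (⊥-elim)
open import Data.Fin using (Fin; zero; suc; toℕ; fromℕ<; punchOut)
import Data.Fin.Properties as FP
open import Data.Fin.Subset using (Subset; _∈_)
open import Data.Fin.Subset.Properties using (_∈?_)
open import Data.List using (length; filter; tabulate)
open import Data.Nat
  using (ℕ; zero; suc; _+_; _*_; _∸_; _≤_; _<_; _≤?_; _<?_; _≟_; _!; z≤n; s≤s; NonZero; >-nonZero)
open import Data.Nat.Divisibility using (_∣_; quotient; ∣-trans; m∣m*n; m≤n⇒m!∣n!; m∣n⇒n≡m*quotient)
open import Data.Nat.DivMod
  using (_/_; _%_; m≡m%n+[m/n]*n; m/n*n≤m; m%n<n; m*n/n≡m; /-monoˡ-≤; m<n*o⇒m/o<n)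
open import Data.Nat.Properties
open import Data.Product using (∃; ∃₂; _×_; _,_; proj₁; proj₂)
open import Data.Sum as Sum using (_⊎_; inj₁; inj₂; [_,_]′)
import Data.Vec as Vec
open import Data.Vec.Properties using (lookup∘tabulate; []=⇒lookup; lookup⇒[]=)
open import Function using (_∘_; id)
open import Function.Bundles using (_⇔_; mk⇔)
open import Function.Definitions using (Surjective)
open import Relation.Binary using (Rel; Reflexive; Transitive; Total; IsStrictTotalOrder; tri<; tri≈; tri>)
open import Relation.Binary.PropositionalEquality
open import Relation.Nullary using (Dec; yes; no; ¬_; does)
open import Relation.Nullary.Decidable using (_→-dec_; _×-dec_; dec-true)
open import Relation.Unary using (Pred; Decidable)
open import Algebra.Properties.Semiring.Sum +-*-semiring
  using (sum; sum-syntax; sum-cong-≗; ∑-distrib-+; ∑-comm; *-distribˡ-sum; sum-replicate-zero)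
open import Defs

private
  variable
    p q : Level
    P : Set p
    x y c : ℕ

-- `when d x` is x if the decision d is positive and 0 otherwise; all
-- counting and weighing below is a sum of such guarded terms.
when : Dec P → ℕ → ℕ
when (yes _) x = x
when (no _)  _ = 0

when-yes : (d : Dec P) → P → when d x ≡ x
when-yes (yes _) _ = refl
when-yes (no ¬p) p = ⊥-elim (¬p p)

when-no : (d : Dec P) → ¬ P → when d x ≡ 0
when-no (yes p) ¬p = ⊥-elim (¬p p)
when-no (no _)  _  = refl

when-≤ : (d : Dec P) → when d x ≤ x
when-≤ (yes _) = ≤-refl
when-≤ (no _)  = z≤n

when-mono : (d : Dec P) → x ≤ y → when d x ≤ when d y
when-mono (yes _) x≤y = x≤y
when-mono (no _)  _   = z≤n

when-⇒ : ∀ {Q : Set q} (d : Dec P) (d' : Dec Q) → (P → Q) → when d x ≤ when d' x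
when-⇒ (yes p) d' p⇒q = ≤-reflexive (sym (when-yes d' (p⇒q p)))
when-⇒ (no _)  d' _   = z≤n

when-zero : (d : Dec P) → when d 0 ≡ 0
when-zero (yes _) = refl
when-zero (no _)  = refl

when-* : (d : Dec P) → when d (c * x) ≡ c * when d x
when-* {c = c} (yes _) = refl
when-* {c = c} (no _)  = sym (*-zeroʳ c)

when-sum : ∀ {m} (d : Dec P) (f : Fin m → ℕ) → when d (sum f) ≡ ∑[ i < m ] when d (f i)
when-sum         (yes _) f = refl
when-sum {m = m} (no _)  f = sym (sum-replicate-zero m)

when-+ : ∀ {r} {Q : Set q} {R : Set r} (d : Dec P) (d₁ : Dec Q) (d₂ : Dec R) →
         (P → Q ⊎ R) → (Q → P) → (R → P) → (Q → ¬ R) → when d x ≡ when d₁ x + when d₂ x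
when-+ (yes p) (yes q) (yes r) _ _ _ q⇒¬r = ⊥-elim (q⇒¬r q r)
when-+ (yes p) (yes q) (no _)  _ _ _ _    = sym (+-identityʳ _)
when-+ (yes p) (no _)  (yes r) _ _ _ _    = refl
when-+ (yes p) (no ¬q) (no ¬r) p⇒q⊎r _ _ _ = ⊥-elim ([ ¬q , ¬r ]′ (p⇒q⊎r p))
when-+ (no ¬p) (yes q) _       _ q⇒p _ _  = ⊥-elim (¬p (q⇒p q))
when-+ (no ¬p) (no _)  (yes r) _ _ r⇒p _  = ⊥-elim (¬p (r⇒p r))
when-+ (no ¬p) (no _)  (no _)  _ _ _ _    = refl

when-+-≤ : ∀ {r} {Q : Set q} {R : Set r} (d : Dec P) (d₁ : Dec Q) (d₂ : Dec R) →
           (Q → P) → (R → P) → (Q → ¬ R) → when d₁ x + when d₂ x ≤ when d x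
when-+-≤ d d₁ d₂ q⇒p r⇒p q⇒¬r with d₁ | d₂
... | yes q | yes r = ⊥-elim (q⇒¬r q r)
... | yes q | no _  = ≤-reflexive (trans (+-identityʳ _) (sym (when-yes d (q⇒p q))))
... | no _  | yes r = ≤-reflexive (sym (when-yes d (r⇒p r)))
... | no _  | no _  = z≤n

sum-zero : ∀ {m} {f : Fin m → ℕ} → (∀ i → f i ≡ 0) → sum f ≡ 0
sum-zero {m = m} f≡0 = trans (sum-cong-≗ f≡0) (sum-replicate-zero m)

sum-const : ∀ m c → ∑[ i < m ] c ≡ m * c
sum-const zero    c = refl
sum-const (suc m) c = cong (c +_) (sum-const m c)

sum-mono : ∀ {m} {f g : Fin m → ℕ} → (∀ i → f i ≤ g i) → sum f ≤ sum g
sum-mono {m = zero}  f≤g = z≤n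
sum-mono {m = suc m} f≤g = +-mono-≤ (f≤g zero) (sum-mono (f≤g ∘ suc))

sum-mono-< : ∀ {m} {f g : Fin m → ℕ} → (∀ i → f i ≤ g i) → ∀ j → f j < g j → sum f < sum g
sum-mono-< {m = suc m} f≤g zero    fj<gj = +-mono-<-≤ fj<gj (sum-mono (f≤g ∘ suc))
sum-mono-< {m = suc m} f≤g (suc j) fj<gj = +-mono-≤-< (f≤g zero) (sum-mono-< (f≤g ∘ suc) j fj<gj)

term≤sum : ∀ {m} (f : Fin m → ℕ) → ∀ i → f i ≤ sum f
term≤sum f zero    = m≤m+n _ _
term≤sum f (suc i) = ≤-trans (term≤sum (f ∘ suc) i) (m≤n+m _ (f zero))

sum-single : ∀ {m} (f : Fin m → ℕ) → ∀ i → (∀ j → j ≢ i → f j ≡ 0) → sum f ≡ f i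
sum-single f zero    f≡0 =
  trans (cong (f zero +_) (sum-zero (λ j → f≡0 (suc j) λ ()))) (+-identityʳ _)
sum-single f (suc i) f≡0 =
  trans (cong (_+ sum (f ∘ suc)) (f≡0 zero λ ()))
        (sum-single (f ∘ suc) i (λ j j≢i → f≡0 (suc j) (j≢i ∘ FP.suc-injective)))

count-as-sum : ∀ {m} {P : Pred (Fin m) p} (P? : Decidable P) → count P? ≡ ∑[ i < m ] when (P? i) 1
count-as-sum P? = count-tabulate id
  where
  count-tabulate : ∀ {k} (h : Fin k → Fin _) →
    length (filter P? (tabulate h)) ≡ ∑[ i < k ] when (P? (h i)) 1
  count-tabulate {zero}  h = refl
  count-tabulate {suc k} h with P? (h zero)
  ... | yes _ = cong suc (count-tabulate (h ∘ suc))
  ... | no  _ = count-tabulate (h ∘ suc)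

total⇒reflexive : ∀ {m r} {_≼_ : Rel (Fin m) r} → Total _≼_ → Reflexive _≼_
total⇒reflexive ≼-total {z} = [ id , id ]′ (≼-total z z)

least : ∀ {m r} (_≼_ : Rel (Fin m) r) → Transitive _≼_ → Total _≼_ →
        {Q : Pred (Fin m) q} → Decidable Q → ∃ Q → ∃ λ y → Q y × ∀ z → Q z → y ≼ z
least {m = suc m} _≼_ ≼-trans ≼-total {Q} Q? (x , qx) with FP.any? (Q? ∘ suc)
... | no none = zero , only-zero x qx ,
                λ { zero _ → total⇒reflexive ≼-total ; (suc k) qk → ⊥-elim (none (k , qk)) }
  where
  only-zero : ∀ z → Q z → Q zero
  only-zero zero    qz = qz
  only-zero (suc k) qk = ⊥-elim (none (k , qk))
... | yes some
  with least (λ a b → suc a ≼ suc b) ≼-trans (λ a b → ≼-total (suc a) (suc b)) (Q? ∘ suc) some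
...   | y , qy , y-least with Q? zero
...     | no ¬q0 = suc y , qy , λ { zero q0 → ⊥-elim (¬q0 q0) ; (suc k) qk → y-least k qk }
...     | yes q0 with ≼-total zero (suc y)
...       | inj₁ 0≼y = zero , q0 ,
                         λ { zero _ → total⇒reflexive ≼-total ; (suc k) qk → ≼-trans 0≼y (y-least k qk) }
...       | inj₂ y≼0 = suc y , qy , λ { zero _ → y≼0 ; (suc k) qk → y-least k qk }

injective⇒surjective : ∀ {m} (f : Fin m → Fin m) → (∀ {x y} → f x ≡ f y → x ≡ y) →
                       ∀ k → ∃ λ v → f v ≡ k
injective⇒surjective {suc m} f f-inj k with FP.any? (λ v → f v FP.≟ k)
... | yes hit = hit
... | no miss with FP.pigeonhole (n<1+n m) (λ v → punchOut {i = k} {j = f v} λ k≡fv → miss (v , sym k≡fv))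
...   | x , y , x<y , fx≡fy = ⊥-elim (FP.<-irrefl (f-inj (FP.punchOut-injective {i = k} _ _ fx≡fy)) x<y)

between? : ∀ lo hi k → Dec (lo ≤ k × k ≤ hi)
between? lo hi k = (lo ≤? k) ×-dec (k ≤? hi)

inRange : (lo hi c t : ℕ) → ℕ
inRange lo hi c t = ∑[ j < t ] when (between? lo hi (c + toℕ j)) 1

inRange-suc : ∀ lo hi c t → inRange lo hi c (suc t) ≡ when (between? lo hi (c + 0)) 1 + inRange lo hi (suc c) t
inRange-suc lo hi c t = cong (when (between? lo hi (c + 0)) 1 +_) (sum-cong-≗ {t} λ j →
  cong (λ k → when (between? lo hi k) 1) (+-suc c (toℕ j)))

inRange-≤ : ∀ lo hi c t → inRange lo hi c t ≤ suc hi ∸ c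
inRange-≤ lo hi c zero    = z≤n
inRange-≤ lo hi c (suc t) with c ≤? hi
... | yes c≤hi = begin
  inRange lo hi c (suc t)                                 ≡⟨ inRange-suc lo hi c t ⟩
  when (between? lo hi (c + 0)) 1 + inRange lo hi (suc c) t ≤⟨ +-mono-≤ (when-≤ (between? lo hi (c + 0)))
                                                                         (inRange-≤ lo hi (suc c) t) ⟩
  1 + (hi ∸ c)                                            ≡⟨ +-∸-assoc 1 c≤hi ⟨
  suc hi ∸ c                                              ∎
  where open ≤-Reasoning
... | no c≰hi = begin
  inRange lo hi c (suc t)                                 ≡⟨ inRange-suc lo hi c t ⟩
  when (between? lo hi (c + 0)) 1 + inRange lo hi (suc c) t ≡⟨ cong (_+ inRange lo hi (suc c) t) first≡0 ⟩
  inRange lo hi (suc c) t                                 ≤⟨ inRange-≤ lo hi (suc c) t ⟩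
  hi ∸ c                                                  ≤⟨ ∸-monoˡ-≤ c (n≤1+n hi) ⟩
  suc hi ∸ c                                              ∎
  where
  open ≤-Reasoning
  first≡0 : when (between? lo hi (c + 0)) 1 ≡ 0
  first≡0 = when-no (between? lo hi (c + 0)) (c≰hi ∘ subst (_≤ hi) (+-identityʳ c) ∘ proj₂)

inRange-≤ˡ : ∀ lo hi c t → c ≤ lo → inRange lo hi c t ≤ suc hi ∸ lo
inRange-≤ˡ lo hi c zero    _    = z≤n
inRange-≤ˡ lo hi c (suc t) c≤lo with m≤n⇒m<n∨m≡n c≤lo
... | inj₂ refl = inRange-≤ c hi c (suc t)
... | inj₁ c<lo = begin
  inRange lo hi c (suc t)                                 ≡⟨ inRange-suc lo hi c t ⟩
  when (between? lo hi (c + 0)) 1 + inRange lo hi (suc c) t ≡⟨ cong (_+ inRange lo hi (suc c) t) first≡0 ⟩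
  inRange lo hi (suc c) t                                 ≤⟨ inRange-≤ˡ lo hi (suc c) t c<lo ⟩
  suc hi ∸ lo                                             ∎
  where
  open ≤-Reasoning
  first≡0 : when (between? lo hi (c + 0)) 1 ≡ 0
  first≡0 = when-no (between? lo hi (c + 0)) (<⇒≱ c<lo ∘ subst (lo ≤_) (+-identityʳ c) ∘ proj₁)

module _ {d : ℕ} .{{_ : NonZero d}} where

  /-upper : ∀ x → x < suc (x / d) * d
  /-upper x = begin-strict
    x                      ≡⟨ m≡m%n+[m/n]*n x d ⟩
    x % d + (x / d) * d    <⟨ +-monoˡ-< ((x / d) * d) (m%n<n x d) ⟩
    d + (x / d) * d        ∎
    where open ≤-Reasoning

  /-lower : ∀ q x → q * d ≤ x → q ≤ x / d
  /-lower q x qd≤x = subst (_≤ x / d) (m*n/n≡m q d) (/-monoˡ-≤ d qd≤x)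

  /-exact : ∀ q x → q * d ≤ x → x < suc q * d → x / d ≡ q
  /-exact q x qd≤x x<q+1d = ≤-antisym (m<1+n⇒m≤n (m<n*o⇒m/o<n x<q+1d)) (/-lower q x qd≤x)

counterexample : ∀ {m} {A : Pred (Fin m) p} {B : Pred (Fin m) q} → Decidable A → Decidable B →
                 ¬ (∀ v → A v → B v) → ∃ λ v → A v × ¬ B v
counterexample {m = m} A? B? ¬A⇒B with FP.¬∀⟶∃¬ m _ (λ v → A? v →-dec B? v) ¬A⇒B
... | v , ¬Av⇒Bv with A? v | B? v
...   | yes a | yes b = ⊥-elim (¬Av⇒Bv λ _ → b)
...   | yes a | no ¬b = v , a , ¬b
...   | no ¬a | _     = ⊥-elim (¬Av⇒Bv λ a → ⊥-elim (¬a a))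

subsetOf : ∀ {m} {S : Pred (Fin m) p} → Decidable S → Subset m
subsetOf S? = Vec.tabulate (λ v → does (S? v))

∈-subsetOf⁺ : ∀ {m} {S : Pred (Fin m) p} (S? : Decidable S) {v} → S v → v ∈ subsetOf S?
∈-subsetOf⁺ S? {v} sv = lookup⇒[]= v (subsetOf S?)
  (trans (lookup∘tabulate (λ u → does (S? u)) v) (dec-true (S? v) sv))

∈-subsetOf⁻ : ∀ {m} {S : Pred (Fin m) p} (S? : Decidable S) {v} → v ∈ subsetOf S? → S v
∈-subsetOf⁻ S? {v} v∈S with S? v | trans (sym (lookup∘tabulate (λ u → does (S? u)) v)) ([]=⇒lookup v∈S)
... | yes sv | _ = sv
... | no  _  | ()

-- Geometry of a proper interval graph along a canonical ordering.
module ProperIntervals {a ℓ : Level} {A : Set a} (_⊏_ : Rel A ℓ) (sto : IsStrictTotalOrder _≡_ _⊏_)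
  {n : ℕ} (G : PIRep _⊏_ n) (pos : Fin n → Fin n) (canonical : CanonicalOrdering _⊏_ G pos) where

  open PIRep G
  open IsStrictTotalOrder sto using (compare) renaming (trans to ⊏-trans)

  _≼_ : A → A → Set (a ⊔ ℓ)
  _≼_ = _≤A_ _⊏_

  ≼-trans : ∀ {x y z} → x ≼ y → y ≼ z → x ≼ z
  ≼-trans (inj₁ x⊏y)  (inj₁ y⊏z)  = inj₁ (⊏-trans x⊏y y⊏z)
  ≼-trans (inj₁ x⊏y)  (inj₂ refl) = inj₁ x⊏y
  ≼-trans (inj₂ refl) y≼z         = y≼z

  _≼?_ : ∀ x y → Dec (x ≼ y)
  x ≼? y with compare x y
  ... | tri< x⊏y _   _   = yes (inj₁ x⊏y)
  ... | tri≈ _   x≡y _   = yes (inj₂ x≡y)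
  ... | tri> ¬x⊏y x≢y _ = no λ { (inj₁ x⊏y) → ¬x⊏y x⊏y ; (inj₂ x≡y) → x≢y x≡y }

  rank : Fin n → ℕ
  rank v = toℕ (pos v)

  rank<n : ∀ v → rank v < n
  rank<n v = FP.toℕ<n (pos v)

  rank-injective : ∀ {u v} → rank u ≡ rank v → u ≡ v
  rank-injective = proj₁ canonical ∘ FP.toℕ-injective

  -- Both endpoints are monotone along the canonical ordering; for right
  -- endpoints this is where properness of the representation is used.
  rank-mono : ∀ {u v} → rank u ≤ rank v → L u ≼ L v × R u ≼ R v
  rank-mono {u} {v} u≤v with m≤n⇒m<n∨m≡n u≤v
  ... | inj₂ u≡v rewrite rank-injective u≡v = inj₂ refl , inj₂ refl
  ... | inj₁ u<v = Lu≼Lv , Ru≼Rv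
    where
    not-after : ¬ LexLess _⊏_ G v u
    not-after v≺u = <-asym u<v (proj₂ canonical v u v≺u)
    Lu≼Lv : L u ≼ L v
    Lu≼Lv with compare (L u) (L v)
    ... | tri< Lu⊏Lv _ _ = inj₁ Lu⊏Lv
    ... | tri≈ _ Lu≡Lv _ = inj₂ Lu≡Lv
    ... | tri> _ _ Lv⊏Lu = ⊥-elim (not-after (inj₁ Lv⊏Lu))
    Ru≼Rv : R u ≼ R v
    Ru≼Rv with compare (R u) (R v)
    ... | tri< Ru⊏Rv _ _ = inj₁ Ru⊏Rv
    ... | tri≈ _ Ru≡Rv _ = inj₂ Ru≡Rv
    ... | tri> _ Ru≢Rv Rv⊏Ru = ⊥-elim (proper u v (Lu≼Lv , inj₁ Rv⊏Ru , inj₂ Ru≢Rv))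

  -- Umbrella property: if s and s' intersect, every two distinct vertices
  -- ranked between them are adjacent.
  umbrella : ∀ s x y s' → rank s ≤ rank x → rank x ≤ rank y → rank y ≤ rank s' →
             L s' ≼ R s → x ≢ y → Adj _⊏_ G x y
  umbrella s x y s' s≤x x≤y y≤s' Ls'≼Rs x≢y =
    x≢y ,
    ≼-trans (proj₁ (rank-mono x≤y)) (valid y) ,
    ≼-trans (proj₁ (rank-mono y≤s')) (≼-trans Ls'≼Rs (proj₂ (rank-mono s≤x)))

  Adj-sym : ∀ {u v} → Adj _⊏_ G u v → Adj _⊏_ G v u
  Adj-sym (u≢v , Lu≼Rv , Lv≼Ru) = u≢v ∘ sym , Lv≼Ru , Lu≼Rv

  Adj? : ∀ u v → Dec (Adj _⊏_ G u v)
  Adj? u v with u FP.≟ v | L u ≼? R v | L v ≼? R u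
  ... | yes u≡v | _         | _         = no λ adj → proj₁ adj u≡v
  ... | no u≢v  | yes Lu≼Rv | yes Lv≼Ru = yes (u≢v , Lu≼Rv , Lv≼Ru)
  ... | no _    | no ¬Lu≼Rv | _         = no λ adj → ¬Lu≼Rv (proj₁ (proj₂ adj))
  ... | no _    | yes _     | no ¬Lv≼Ru = no λ adj → ¬Lv≼Ru (proj₂ (proj₂ adj))

  vertexAt : (x : ℕ) → .(x < n) → Fin n
  vertexAt x x<n = proj₁ (injective⇒surjective pos (proj₁ canonical) (fromℕ< x<n))

  rank-vertexAt : ∀ x .(x<n : x < n) → rank (vertexAt x x<n) ≡ x
  rank-vertexAt x x<n =
    trans (cong toℕ (proj₂ (injective⇒surjective pos (proj₁ canonical) (fromℕ< x<n))))
          (FP.toℕ-fromℕ< x<n)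

  vertexAt-rank : ∀ v → vertexAt (rank v) (rank<n v) ≡ v
  vertexAt-rank v = rank-injective (rank-vertexAt (rank v) (rank<n v))

  Reaches : Fin n → Fin n → Set (a ⊔ ℓ)
  Reaches B v = rank v ≤ rank B × L B ≼ R v

  reaches? : ∀ B v → Dec (Reaches B v)
  reaches? B v = (rank v ≤? rank B) ×-dec (L B ≼? R v)

  earliest : ∀ {s} {S : Fin n → Set s} → Decidable S → ∃ S →
             ∃ λ v → S v × ∀ z → S z → rank v ≤ rank z
  earliest = least (λ x y → rank x ≤ rank y) ≤-trans (λ x y → ≤-total (rank x) (rank y))

  latest : ∀ {s} {S : Fin n → Set s} → Decidable S → ∃ S →
           ∃ λ v → S v × ∀ z → S z → rank z ≤ rank v
  latest = least (λ x y → rank y ≤ rank x) (λ y≤x z≤y → ≤-trans z≤y y≤x)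
                 (λ x y → ≤-total (rank y) (rank x))

  module _ {q} {Q : Fin n → Set q} where

    _++ᵖ_ : ∀ {u v w} → PathIn _⊏_ G Q u v → PathIn _⊏_ G Q v w → PathIn _⊏_ G Q u w
    here          ++ᵖ ρ = ρ
    step adj qw π ++ᵖ ρ = step adj qw (π ++ᵖ ρ)

    reverseᵖ : ∀ {u v} → PathIn _⊏_ G Q u v → Q u → PathIn _⊏_ G Q v u
    reverseᵖ here             _  = here
    reverseᵖ (step adj qw π) qu = reverseᵖ π qw ++ᵖ step (Adj-sym adj) qu here

    exit : ∀ {s} {S : Fin n → Set s} → (∀ v → Dec (S v)) →
           ∀ {u v} → PathIn _⊏_ G Q u v → S u → ¬ S v →
           ∃₂ λ x y → Adj _⊏_ G x y × S x × ¬ S y × Q y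
    exit S? here su ¬sv = ⊥-elim (¬sv su)
    exit S? {u} (step {w = w} adj qw π) su ¬sv with S? w
    ... | yes sw = exit S? π sw ¬sv
    ... | no ¬sw = u , w , adj , su , ¬sw , qw

  -- Each
  -- vertex gets weight M / |part|, with M = C!, so every part weighs exactly
  -- M; the vertex v then joins block ⌊(weight of the vertices before v) / M⌋.
  module Rounding {lam C t : ℕ} (p : Fin n → Fin t) (ip : IsPartition _⊏_ G p lam C) where

    open IsPartition ip

    size : Fin t → ℕ
    size = partSize _⊏_ G p

    size-as-sum : ∀ i → size i ≡ ∑[ v < n ] when (p v FP.≟ i) 1
    size-as-sum i = count-as-sum (λ v → p v FP.≟ i)

    size≥1 : ∀ i → 1 ≤ size i
    size≥1 i with nonempty i
    ... | v , v∈i = begin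
      1                               ≡⟨ when-yes (p v FP.≟ i) (v∈i refl) ⟨
      when (p v FP.≟ i) 1             ≤⟨ term≤sum (λ u → when (p u FP.≟ i) 1) v ⟩
      ∑[ u < n ] when (p u FP.≟ i) 1  ≡⟨ size-as-sum i ⟨
      size i                          ∎
      where open ≤-Reasoning

    -- The weight unit; it is divisible by every possible part size.
    M : ℕ
    M = C !

    instance
      M≢0 : NonZero M
      M≢0 = >-nonZero (1≤n! C)

    size∣M : ∀ i → size i ∣ M
    size∣M i with size i | size≥1 i | bounded i
    ... | suc k | _ | k<C = ∣-trans (m∣m*n (k !)) (m≤n⇒m!∣n! k<C)

    -- weight v = M / size (p v), which is at least 1 and at most M.
    weight : Fin n → ℕ
    weight v = quotient (size∣M (p v))

    size*weight : ∀ v → size (p v) * weight v ≡ M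
    size*weight v = sym (m∣n⇒n≡m*quotient (size∣M (p v)))

    weight≥1 : ∀ v → 1 ≤ weight v
    weight≥1 v with weight v | size*weight v
    ... | zero  | s*0≡M = ⊥-elim (<⇒≢ (1≤n! C) (trans (sym (*-zeroʳ (size (p v)))) s*0≡M))
    ... | suc _ | _     = s≤s z≤n

    weight≤M : ∀ v → weight v ≤ M
    weight≤M v = begin
      weight v                   ≤⟨ m≤n*m (weight v) (size (p v)) {{>-nonZero (size≥1 (p v))}} ⟩
      size (p v) * weight v      ≡⟨ size*weight v ⟩
      M                          ∎
      where open ≤-Reasoning

    M≤C*weight : ∀ v → M ≤ C * weight v
    M≤C*weight v = begin
      M                          ≡⟨ size*weight v ⟨
      size (p v) * weight v      ≤⟨ *-monoˡ-≤ (weight v) (bounded (p v)) ⟩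
      C * weight v               ∎
      where open ≤-Reasoning

    partWeight : Fin t → ℕ
    partWeight i = ∑[ v < n ] when (p v FP.≟ i) (weight v)

    partWeight≡M : ∀ i → partWeight i ≡ M
    partWeight≡M i = *-cancelˡ-≡ (partWeight i) M (size i) {{>-nonZero (size≥1 i)}} (begin
      size i * partWeight i                          ≡⟨ *-distribˡ-sum {n} (size i) _ ⟩
      ∑[ v < n ] (size i * when (p v FP.≟ i) (weight v)) ≡⟨ sum-cong-≗ {n} termwise ⟩
      ∑[ v < n ] (M * when (p v FP.≟ i) 1)           ≡⟨ *-distribˡ-sum {n} M _ ⟨
      M * (∑[ v < n ] when (p v FP.≟ i) 1)           ≡⟨ cong (M *_) (size-as-sum i) ⟨
      M * size i                                     ≡⟨ *-comm M (size i) ⟩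
      size i * M                                     ∎)
      where
      open ≡-Reasoning
      termwise : ∀ v → size i * when (p v FP.≟ i) (weight v) ≡ M * when (p v FP.≟ i) 1
      termwise v with p v FP.≟ i
      ... | yes refl = trans (size*weight v) (sym (*-identityʳ M))
      ... | no  _    = trans (*-zeroʳ (size i)) (sym (*-zeroʳ M))

    prefix : ℕ → ℕ
    prefix k = ∑[ v < n ] when (rank v <? k) (weight v)

    partPrefix : Fin t → ℕ → ℕ
    partPrefix i k = ∑[ v < n ] when (rank v <? k) (when (p v FP.≟ i) (weight v))

    prefix-split : ∀ k → prefix k ≡ ∑[ i < t ] partPrefix i k
    prefix-split k = sym (begin
      ∑[ i < t ] partPrefix i k
        ≡⟨ ∑-comm (λ i v → when (rank v <? k) (when (p v FP.≟ i) (weight v))) ⟩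
      ∑[ v < n ] ∑[ i < t ] when (rank v <? k) (when (p v FP.≟ i) (weight v))
        ≡⟨ sum-cong-≗ {n} (λ v → when-sum (rank v <? k) (λ i → when (p v FP.≟ i) (weight v))) ⟨
      ∑[ v < n ] when (rank v <? k) (∑[ i < t ] when (p v FP.≟ i) (weight v))
        ≡⟨ sum-cong-≗ {n} (λ v → cong (when (rank v <? k)) (own-part v)) ⟩
      prefix k ∎)
      where
      open ≡-Reasoning
      own-part : ∀ v → ∑[ i < t ] when (p v FP.≟ i) (weight v) ≡ weight v
      own-part v = trans (sum-single (λ i → when (p v FP.≟ i) (weight v)) (p v)
                                     (λ i i≢pv → when-no (p v FP.≟ i) (i≢pv ∘ sym)))
                         (when-yes (p v FP.≟ p v) refl)

    partPrefix≤M : ∀ i k → partPrefix i k ≤ M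
    partPrefix≤M i k = ≤-trans (sum-mono (λ v → when-≤ (rank v <? k))) (≤-reflexive (partWeight≡M i))

    Before After : Fin t → ℕ → Set
    Before i k = ∀ v → p v ≡ i → rank v < k
    After  i k = ∀ v → p v ≡ i → k ≤ rank v

    before? : ∀ i k → Dec (Before i k)
    before? i k = FP.all? (λ v → (p v FP.≟ i) →-dec (rank v <? k))

    partPrefix-before : ∀ i k → Before i k → partPrefix i k ≡ M
    partPrefix-before i k before = trans (sum-cong-≗ {n} termwise) (partWeight≡M i)
      where
      termwise : ∀ v → when (rank v <? k) (when (p v FP.≟ i) (weight v)) ≡ when (p v FP.≟ i) (weight v)
      termwise v with p v FP.≟ i
      ... | yes v∈i = when-yes (rank v <? k) (before v v∈i)
      ... | no  _   = when-zero (rank v <? k)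

    partPrefix-after : ∀ i k → After i k → partPrefix i k ≡ 0
    partPrefix-after i k after = sum-zero termwise
      where
      termwise : ∀ v → when (rank v <? k) (when (p v FP.≟ i) (weight v)) ≡ 0
      termwise v with p v FP.≟ i
      ... | yes v∈i = when-no (rank v <? k) (≤⇒≯ (after v v∈i))
      ... | no  _   = when-zero (rank v <? k)

    prefixSum-step : ∀ (g : Fin n → ℕ) x .(x<n : x < n) →
      ∑[ v < n ] when (rank v <? suc x) (g v) ≡ ∑[ v < n ] when (rank v <? x) (g v) + g (vertexAt x x<n)
    prefixSum-step g x x<n = begin
      ∑[ v < n ] when (rank v <? suc x) (g v)
        ≡⟨ sum-cong-≗ {n} split-term ⟩
      ∑[ v < n ] (when (rank v <? x) (g v) + when (rank v ≟ x) (g v))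
        ≡⟨ ∑-distrib-+ (λ v → when (rank v <? x) (g v)) (λ v → when (rank v ≟ x) (g v)) ⟩
      ∑[ v < n ] when (rank v <? x) (g v) + ∑[ v < n ] when (rank v ≟ x) (g v)
        ≡⟨ cong (∑[ v < n ] when (rank v <? x) (g v) +_) at-x ⟩
      ∑[ v < n ] when (rank v <? x) (g v) + g (vertexAt x x<n) ∎
      where
      open ≡-Reasoning
      split-term : ∀ v → when (rank v <? suc x) (g v) ≡ when (rank v <? x) (g v) + when (rank v ≟ x) (g v)
      split-term v = when-+ (rank v <? suc x) (rank v <? x) (rank v ≟ x)
        (m≤n⇒m<n∨m≡n ∘ m<1+n⇒m≤n) m<n⇒m<1+n (s≤s ∘ ≤-reflexive) <⇒≢
      at-x : ∑[ v < n ] when (rank v ≟ x) (g v) ≡ g (vertexAt x x<n)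
      at-x = trans (sum-single _ (vertexAt x x<n) (λ v v≢vx → when-no (rank v ≟ x) (v≢vx ∘ at-rank-x v)))
                   (when-yes (rank (vertexAt x x<n) ≟ x) (rank-vertexAt x x<n))
        where
        at-rank-x : ∀ v → rank v ≡ x → v ≡ vertexAt x x<n
        at-rank-x v v≡x = rank-injective (trans v≡x (sym (rank-vertexAt x x<n)))

    -- A vertex is not counted in the prefix of its own part at its own rank.
    partPrefix-own<M : ∀ v → partPrefix (p v) (rank v) < M
    partPrefix-own<M v = begin-strict
      partPrefix (p v) (rank v)                                     <⟨ m<m+n _ v-counted ⟩
      partPrefix (p v) (rank v) + g v                               ≡⟨ cong (partPrefix (p v) (rank v) +_) (cong g (vertexAt-rank v)) ⟨
      partPrefix (p v) (rank v) + g (vertexAt (rank v) (rank<n v))  ≡⟨ prefixSum-step g (rank v) (rank<n v) ⟨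
      partPrefix (p v) (suc (rank v))                               ≤⟨ partPrefix≤M (p v) (suc (rank v)) ⟩
      M                                                             ∎
      where
      open ≤-Reasoning
      g : Fin n → ℕ
      g u = when (p u FP.≟ p v) (weight u)
      v-counted : 0 < g v
      v-counted = subst (0 <_) (sym (when-yes (p v FP.≟ p v) refl)) (weight≥1 v)

    prefix-step : ∀ x .(x<n : x < n) → prefix (suc x) ≡ prefix x + weight (vertexAt x x<n)
    prefix-step = prefixSum-step weight

    prefix-mono : ∀ {x y} → x ≤ y → prefix x ≤ prefix y
    prefix-mono {x} {y} x≤y = sum-mono termwise
      where
      termwise : ∀ v → when (rank v <? x) (weight v) ≤ when (rank v <? y) (weight v)
      termwise v with rank v <? x
      ... | yes v<x = ≤-reflexive (sym (when-yes (rank v <? y) (<-≤-trans v<x x≤y)))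
      ... | no  _   = z≤n

    prefix-zero : prefix 0 ≡ 0
    prefix-zero = sum-zero (λ v → when-no {x = weight v} (rank v <? 0) λ ())

    prefix-total : prefix n ≡ t * M
    prefix-total = begin
      prefix n                   ≡⟨ prefix-split n ⟩
      ∑[ i < t ] partPrefix i n  ≡⟨ sum-cong-≗ {t} (λ i → partPrefix-before i n (λ v _ → rank<n v)) ⟩
      ∑[ i < t ] M               ≡⟨ sum-const t M ⟩
      t * M                      ∎
      where open ≡-Reasoning

    prefix-past : ∀ v → prefix (suc (rank v)) ≡ prefix (rank v) + weight v
    prefix-past v = trans (prefix-step (rank v) (rank<n v))
                          (cong (λ u → prefix (rank v) + weight u) (vertexAt-rank v))

    label : Fin n → ℕ
    label v = prefix (rank v) / M

    -- Only the bound itself matters; keeping its proof opaque stops the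
    -- type checker from unfolding it inside every `block v`.
    opaque
      label<t : ∀ v → label v < t
      label<t v = m<n*o⇒m/o<n (begin-strict
        prefix (rank v)            <⟨ m<m+n (prefix (rank v)) (weight≥1 v) ⟩
        prefix (rank v) + weight v ≡⟨ prefix-past v ⟨
        prefix (suc (rank v))      ≤⟨ prefix-mono (rank<n v) ⟩
        prefix n                   ≡⟨ prefix-total ⟩
        t * M                      ∎)
        where open ≤-Reasoning

    block : Fin n → Fin t
    block v = fromℕ< (label<t v)

    label≡block : ∀ {v j} → block v ≡ j → label v ≡ toℕ j
    label≡block {v} refl = sym (FP.toℕ-fromℕ< (label<t v))

    block≡label : ∀ {v j} → label v ≡ toℕ j → block v ≡ j
    block≡label {v} v≡j = FP.toℕ-injective (trans (FP.toℕ-fromℕ< (label<t v)) v≡j)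

    label-mono : ∀ {u v} → rank u ≤ rank v → label u ≤ label v
    label-mono u≤v = /-monoˡ-≤ M (prefix-mono u≤v)

    blocks : AllBlocks _⊏_ G block pos
    blocks u v w u~w u≤v v≤w = block≡label (trans (≤-antisym
      (≤-trans (label-mono v≤w) (≤-reflexive (trans (label≡block {w} refl) (sym (label≡block u~w)))))
      (label-mono u≤v)) (label≡block {u} refl))

    -- The first cut whose prefix reaches q * M stays below (q + 1) * M,
    -- because a single vertex weighs at most M.
    first-cut : ∀ q x → x ≤ n → q * M ≤ prefix x →
                ∃ λ y → y ≤ x × q * M ≤ prefix y × prefix y < suc q * M
    first-cut q zero    _     qM≤p0 =
      0 , z≤n , qM≤p0 , subst (_< suc q * M) (sym prefix-zero) (<-≤-trans (1≤n! C) (m≤m+n M (q * M)))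
    first-cut q (suc x) x<n qM≤px+1 with q * M ≤? prefix x
    ... | yes qM≤px = let (y , y≤x , rest) = first-cut q x (<⇒≤ x<n) qM≤px
                      in  y , m≤n⇒m≤1+n y≤x , rest
    ... | no  qM≰px = suc x , ≤-refl , qM≤px+1 , (begin-strict
      prefix (suc x)                      ≡⟨ prefix-step x x<n ⟩
      prefix x + weight (vertexAt x x<n)  ≤⟨ +-monoʳ-≤ (prefix x) (weight≤M (vertexAt x x<n)) ⟩
      prefix x + M                        <⟨ +-monoˡ-< M (≰⇒> qM≰px) ⟩
      q * M + M                           ≡⟨ +-comm (q * M) M ⟩
      suc q * M                           ∎)
      where open ≤-Reasoning

    -- Every block j is nonempty: the first cut whose prefix reaches j * M
    -- lies strictly inside the ordering, and the vertex there has label j.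
    block-surjective : Surjective _≡_ _≡_ block
    block-surjective j with first-cut (toℕ j) n ≤-refl jM≤prefix-n
      where
      jM≤prefix-n : toℕ j * M ≤ prefix n
      jM≤prefix-n = ≤-trans (*-monoˡ-≤ M (<⇒≤ (FP.toℕ<n j))) (≤-reflexive (sym prefix-total))
    ... | y , y≤n , lower , upper with m≤n⇒m<n∨m≡n y≤n
    ...   | inj₂ refl = ⊥-elim (<⇒≱ (FP.toℕ<n j) (m<1+n⇒m≤n t<j+1))
      where
      t<j+1 : t < suc (toℕ j)
      t<j+1 = *-cancelʳ-< M t (suc (toℕ j)) (subst (_< suc (toℕ j) * M) prefix-total upper)
    ...   | inj₁ y<n  = vertexAt y y<n , λ { refl → block≡label (begin
      prefix (rank (vertexAt y y<n)) / M  ≡⟨ cong (λ k → prefix k / M) (rank-vertexAt y y<n) ⟩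
      prefix y / M                        ≡⟨ /-exact (toℕ j) (prefix y) lower upper ⟩
      toℕ j                               ∎) }
      where open ≡-Reasoning

    Crossing : Fin t → ℕ → Set (a ⊔ ℓ)
    Crossing i k = ∃₂ λ s s' → Adj _⊏_ G s s' × rank s < k × k ≤ rank s' × p s' ≡ i

    -- Since parts are connected, a part on neither side of a cut crosses it.
    sides : ∀ i k → Before i k ⊎ After i k ⊎ Crossing i k
    sides i k with before? i k
    ... | yes before = inj₁ before
    ... | no ¬before with FP.all? (λ v → (p v FP.≟ i) →-dec (k ≤? rank v))
    ...   | yes after = inj₂ (inj₁ after)
    ...   | no ¬after with counterexample (λ v → p v FP.≟ i) (λ v → rank v <? k) ¬before
                         | counterexample (λ v → p v FP.≟ i) (λ v → k ≤? rank v) ¬after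
    ...     | u , u∈i , u≮k | v , v∈i , k≰v
      with exit (λ w → rank w <? k) (connected i v u v∈i u∈i) (≰⇒> k≰v) u≮k
    ...       | s , s' , adj , s<k , s'≮k , s'∈i =
      inj₂ (inj₂ (s , s' , adj , s<k , ≮⇒≥ s'≮k , s'∈i))

    prefix-at-clean-cut : ∀ k → (∀ i → Before i k ⊎ After i k) → ∃ λ c → prefix k ≡ c * M
    prefix-at-clean-cut k clean = ∑[ i < t ] partsBefore i , (begin
      prefix k                              ≡⟨ prefix-split k ⟩
      ∑[ i < t ] partPrefix i k             ≡⟨ sum-cong-≗ {t} (λ i → partPrefix-clean i (clean i)) ⟩
      ∑[ i < t ] (M * partsBefore i)        ≡⟨ *-distribˡ-sum {t} M partsBefore ⟨
      M * (∑[ i < t ] partsBefore i)        ≡⟨ *-comm M _ ⟩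
      (∑[ i < t ] partsBefore i) * M        ∎)
      where
      open ≡-Reasoning
      partsBefore : Fin t → ℕ
      partsBefore i = [ (λ _ → 1) , (λ _ → 0) ]′ (clean i)
      partPrefix-clean : ∀ i (side : Before i k ⊎ After i k) →
                         partPrefix i k ≡ M * [ (λ _ → 1) , (λ _ → 0) ]′ side
      partPrefix-clean i (inj₁ before) = trans (partPrefix-before i k before) (sym (*-identityʳ M))
      partPrefix-clean i (inj₂ after)  = trans (partPrefix-after i k after) (sym (*-zeroʳ M))

    -- Consecutive vertices that are not adjacent lie in different blocks:
    -- by the umbrella property no part crosses the cut between them.
    consecutive-adjacent : ∀ w v → rank v ≡ suc (rank w) → label w ≡ label v → Adj _⊏_ G w v
    consecutive-adjacent w v v≡w+1 same with Adj? w v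
    ... | yes adj = adj
    ... | no ¬adj with prefix-at-clean-cut (rank v) clean
      where
      clean : ∀ i → Before i (rank v) ⊎ After i (rank v)
      clean i with sides i (rank v)
      ... | inj₁ before = inj₁ before
      ... | inj₂ (inj₁ after) = inj₂ after
      ... | inj₂ (inj₂ (s , s' , adj , s<v , v≤s' , _)) =
        ⊥-elim (¬adj (umbrella s w v s' (m<1+n⇒m≤n (subst (rank s <_) v≡w+1 s<v)) w≤v v≤s'
                                        (proj₂ (proj₂ adj)) w≢v))
        where
        w≤v : rank w ≤ rank v
        w≤v = ≤-trans (n≤1+n (rank w)) (≤-reflexive (sym v≡w+1))
        w≢v : w ≢ v
        w≢v w≡v = 1+n≰n (≤-reflexive (trans (sym v≡w+1) (cong rank (sym w≡v))))
    ... | c , prefix≡cM = ⊥-elim (<⇒≢ label-jump same)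
      where
      label-jump : label w < label v
      label-jump = begin-strict
        prefix (rank w) / M  <⟨ m<n*o⇒m/o<n (begin-strict
            prefix (rank w)             <⟨ m<m+n (prefix (rank w)) (weight≥1 w) ⟩
            prefix (rank w) + weight w  ≡⟨ prefix-past w ⟨
            prefix (suc (rank w))       ≡⟨ cong prefix v≡w+1 ⟨
            prefix (rank v)             ≡⟨ prefix≡cM ⟩
            c * M                       ∎) ⟩
        c                    ≡⟨ m*n/n≡m c M ⟨
        c * M / M            ≡⟨ cong (_/ M) prefix≡cM ⟨
        prefix (rank v) / M  ∎
        where open ≤-Reasoning

    walk : ∀ j d u v → rank v ≡ d + rank u → block u ≡ j → block v ≡ j →
           PathIn _⊏_ G (λ z → block z ≡ j) u v
    walk j zero    u v v≡u u∈j v∈j rewrite rank-injective v≡u = here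
    walk j (suc d) u v v≡d+1+u u∈j v∈j =
      walk j d u w (rank-vertexAt (d + rank u) w<n) u∈j w∈j ++ᵖ step w~v v∈j here
      where
      w<n : d + rank u < n
      w<n = <-trans (≤-reflexive (sym v≡d+1+u)) (rank<n v)
      w : Fin n
      w = vertexAt (d + rank u) w<n
      v≡w+1 : rank v ≡ suc (rank w)
      v≡w+1 = trans v≡d+1+u (cong suc (sym (rank-vertexAt (d + rank u) w<n)))
      w∈j : block w ≡ j
      w∈j = trans (blocks u w v (trans u∈j (sym v∈j))
                         (≤-trans (m≤n+m (rank u) d) (≤-reflexive (sym (rank-vertexAt (d + rank u) w<n))))
                         (≤-trans (n≤1+n (rank w)) (≤-reflexive (sym v≡w+1))))
                  u∈j
      w~v : Adj _⊏_ G w v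
      w~v = consecutive-adjacent w v v≡w+1 (trans (label≡block w∈j) (sym (label≡block v∈j)))

    block-connected : ∀ j u v → block u ≡ j → block v ≡ j → PathIn _⊏_ G (λ z → block z ≡ j) u v
    block-connected j u v u∈j v∈j with ≤-total (rank u) (rank v)
    ... | inj₁ u≤v = walk j (rank v ∸ rank u) u v (sym (m∸n+n≡m u≤v)) u∈j v∈j
    ... | inj₂ v≤u = reverseᵖ (walk j (rank u ∸ rank v) v u (sym (m∸n+n≡m v≤u)) v∈j u∈j) v∈j

    -- Counting a set of vertices against its weight: each weight is at least M / C.
    count≤weight : ∀ {s} {S : Fin n → Set s} (S? : Decidable S) →
                   M * ∑[ v < n ] when (S? v) 1 ≤ C * ∑[ v < n ] when (S? v) (weight v)
    count≤weight S? = begin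
      M * ∑[ v < n ] when (S? v) 1          ≡⟨ *-distribˡ-sum {n} M _ ⟩
      ∑[ v < n ] (M * when (S? v) 1)        ≤⟨ sum-mono termwise ⟩
      ∑[ v < n ] (C * when (S? v) (weight v)) ≡⟨ *-distribˡ-sum {n} C _ ⟨
      C * ∑[ v < n ] when (S? v) (weight v) ∎
      where
      open ≤-Reasoning
      termwise : ∀ v → M * when (S? v) 1 ≤ C * when (S? v) (weight v)
      termwise v = begin
        M * when (S? v) 1        ≡⟨ when-* {c = M} {x = 1} (S? v) ⟨
        when (S? v) (M * 1)      ≡⟨ cong (when (S? v)) (*-identityʳ M) ⟩
        when (S? v) M            ≤⟨ when-mono (S? v) (M≤C*weight v) ⟩
        when (S? v) (C * weight v) ≡⟨ when-* {c = C} {x = weight v} (S? v) ⟩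
        C * when (S? v) (weight v) ∎

    module BlockSize (j : Fin t)
                     (u : Fin n) (u∈j : block u ≡ j) (u-last : ∀ z → block z ≡ j → rank z ≤ rank u)
                     (v₀ : Fin n) (v₀∈j : block v₀ ≡ j) (v₀-first : ∀ z → block z ≡ j → rank v₀ ≤ rank z)
                     where

      Early : Fin n → Set
      Early v = block v ≡ j × rank v < rank u

      early? : Decidable Early
      early? v = (block v FP.≟ j) ×-dec (rank v <? rank u)

      earlyCount earlyWeight : ℕ
      earlyCount  = ∑[ v < n ] when (early? v) 1
      earlyWeight = ∑[ v < n ] when (early? v) (weight v)

      size≡earlyCount+1 : partSize _⊏_ G block j ≡ earlyCount + 1
      size≡earlyCount+1 = begin
        partSize _⊏_ G block j
          ≡⟨ count-as-sum (λ v → block v FP.≟ j) ⟩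
        ∑[ v < n ] when (block v FP.≟ j) 1
          ≡⟨ sum-cong-≗ {n} early-or-last ⟩
        ∑[ v < n ] (when (early? v) 1 + when (v FP.≟ u) 1)
          ≡⟨ ∑-distrib-+ (λ v → when (early? v) 1) (λ v → when (v FP.≟ u) 1) ⟩
        earlyCount + ∑[ v < n ] when (v FP.≟ u) 1
          ≡⟨ cong (earlyCount +_) only-u ⟩
        earlyCount + 1 ∎
        where
        open ≡-Reasoning
        early-or-last : ∀ v → when (block v FP.≟ j) 1 ≡ when (early? v) 1 + when (v FP.≟ u) 1
        early-or-last v = when-+ (block v FP.≟ j) (early? v) (v FP.≟ u)
          (λ v∈j → Sum.map (v∈j ,_) rank-injective (m≤n⇒m<n∨m≡n (u-last v v∈j)))
          proj₁ (λ { refl → u∈j }) (λ { (_ , v<u) refl → <-irrefl refl v<u })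
        only-u : ∑[ v < n ] when (v FP.≟ u) 1 ≡ 1
        only-u = trans (sum-single _ u (λ v → when-no (v FP.≟ u))) (when-yes (u FP.≟ u) refl)

      -- The early members sit between the cuts at v₀ and u, whose prefixes
      -- are at least j * M and below (j + 1) * M.
      earlyWeight<M : earlyWeight < M
      earlyWeight<M = +-cancelˡ-< (toℕ j * M) earlyWeight M (begin-strict
        toℕ j * M + earlyWeight           ≡⟨ cong (λ l → l * M + earlyWeight) (label≡block v₀∈j) ⟨
        label v₀ * M + earlyWeight        ≤⟨ +-monoˡ-≤ earlyWeight (m/n*n≤m (prefix (rank v₀)) M) ⟩
        prefix (rank v₀) + earlyWeight    ≤⟨ below-u ⟩
        prefix (rank u)                   <⟨ /-upper (prefix (rank u)) ⟩
        suc (label u) * M                 ≡⟨ cong (λ l → suc l * M) (label≡block u∈j) ⟩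
        suc (toℕ j) * M                   ≡⟨ +-comm M (toℕ j * M) ⟩
        toℕ j * M + M                     ∎)
        where
        open ≤-Reasoning
        -- the vertices before v₀ and the early ones are disjoint, and all are before u
        below-u : prefix (rank v₀) + earlyWeight ≤ prefix (rank u)
        below-u = begin
          prefix (rank v₀) + earlyWeight
            ≡⟨ ∑-distrib-+ (λ v → when (rank v <? rank v₀) (weight v)) _ ⟨
          ∑[ v < n ] (when (rank v <? rank v₀) (weight v) + when (early? v) (weight v))
            ≤⟨ sum-mono (λ v → when-+-≤ (rank v <? rank u) (rank v <? rank v₀) (early? v)
                 (λ v<v₀ → <-≤-trans v<v₀ (v₀-first u u∈j)) proj₂
                 (λ v<v₀ (v∈j , _) → <⇒≱ v<v₀ (v₀-first v v∈j))) ⟩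
          prefix (rank u) ∎

      -- M * (|block| - 1) ≤ C * earlyWeight < C * M.
      size≤C : partSize _⊏_ G block j ≤ C
      size≤C = subst (_≤ C) (trans (+-comm 1 earlyCount) (sym size≡earlyCount+1)) earlyCount<C
        where
        C≢0 : NonZero C
        C≢0 = >-nonZero (≤-trans (size≥1 j) (bounded j))
        earlyCount<C : earlyCount < C
        earlyCount<C = *-cancelˡ-< M earlyCount C (begin-strict
          M * earlyCount     ≤⟨ count≤weight early? ⟩
          C * earlyWeight    <⟨ *-monoʳ-< C {{C≢0}} earlyWeight<M ⟩
          C * M              ≡⟨ *-comm C M ⟩
          M * C              ∎)
          where open ≤-Reasoning

    block-size : ∀ j → partSize _⊏_ G block j ≤ C
    block-size j with latest (λ v → block v FP.≟ j) member | earliest (λ v → block v FP.≟ j) member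
      where
      member : ∃ λ v → block v ≡ j
      member = let (v , v∈j) = block-surjective j in v , v∈j refl
    ... | u , u∈j , u-last | v₀ , v₀∈j , v₀-first =
      BlockSize.size≤C j u u∈j u-last v₀ v₀∈j v₀-first

    -- The window of ranks from a₀ to B
    -- is a clique of G, and the blocks met by K are counted against the parts
    -- of p met by the window.
    module CliqueBound (K : Subset n) (K-clique : IsClique _⊏_ G K)
                       (B : Fin n) (B∈K : B ∈ K) (B-last : ∀ z → z ∈ K → rank z ≤ rank B)
                       (a₀ : Fin n) (a₀-reaches : Reaches B a₀)
                       (a₀-first : ∀ z → Reaches B z → rank a₀ ≤ rank z) where

      inWindow? : ∀ v → Dec (rank a₀ ≤ rank v × rank v ≤ rank B)
      inWindow? v = between? (rank a₀) (rank B) (rank v)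

      window : Subset n
      window = subsetOf inWindow?

      -- The window is a clique by the umbrella property, since a₀ reaches B.
      window-clique : IsClique _⊏_ G window
      window-clique u v u∈W v∈W u≢v
        with ∈-subsetOf⁻ inWindow? u∈W | ∈-subsetOf⁻ inWindow? v∈W | ≤-total (rank u) (rank v)
      ... | a₀≤u , _ | _ , v≤B | inj₁ u≤v = umbrella a₀ u v B a₀≤u u≤v v≤B (proj₂ a₀-reaches) u≢v
      ... | _ , u≤B | a₀≤v , _ | inj₂ v≤u =
        Adj-sym (umbrella a₀ v u B a₀≤v v≤u u≤B (proj₂ a₀-reaches) (u≢v ∘ sym))

      K-reaches : ∀ v → v ∈ K → Reaches B v
      K-reaches v v∈K with v FP.≟ B
      ... | yes refl = ≤-refl , valid B
      ... | no  v≢B  = B-last v v∈K , proj₂ (proj₂ (K-clique v B v∈K B∈K v≢B))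

      blocksMet≤ : partsMet _⊏_ G block K ≤ suc (label B) ∸ label a₀
      blocksMet≤ = begin
        partsMet _⊏_ G block K                               ≡⟨ count-as-sum metBy? ⟩
        ∑[ j < t ] when (metBy? j) 1                          ≤⟨ sum-mono termwise ⟩
        inRange lo hi 0 t                                     ≤⟨ inRange-≤ˡ lo hi 0 t z≤n ⟩
        suc hi ∸ lo                                           ∎
        where
        open ≤-Reasoning
        lo = label a₀
        hi = label B
        metBy? : ∀ j → Dec (∃ λ v → v ∈ K × block v ≡ j)
        metBy? j = FP.any? (λ v → (v ∈? K) ×-dec (block v FP.≟ j))
        label-range : ∀ j → (∃ λ v → v ∈ K × block v ≡ j) → lo ≤ toℕ j × toℕ j ≤ hi
        label-range j (v , v∈K , v∈j) =
          ≤-trans (label-mono (a₀-first v (K-reaches v v∈K))) (≤-reflexive (label≡block v∈j)) ,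
          ≤-trans (≤-reflexive (sym (label≡block v∈j))) (label-mono (B-last v v∈K))
        termwise : ∀ j → when (metBy? j) 1 ≤ when (between? lo hi (toℕ j)) 1
        termwise j = when-⇒ (metBy? j) (between? lo hi (toℕ j)) (label-range j)

      meets? : ∀ i → Dec (∃ λ v → v ∈ window × p v ≡ i)
      meets? i = FP.any? (λ v → (v ∈? window) ×-dec (p v FP.≟ i))

      I D : ℕ
      I = ∑[ i < t ] when (before? i (rank a₀)) 1
      D = ∑[ i < t ] when (meets? i) 1

      I≤label-a₀ : I ≤ label a₀
      I≤label-a₀ = /-lower I (prefix (rank a₀)) (begin
        I * M                                        ≡⟨ *-comm I M ⟩
        M * I                                        ≡⟨ *-distribˡ-sum {t} M _ ⟩
        ∑[ i < t ] (M * when (before? i (rank a₀)) 1)  ≤⟨ sum-mono termwise ⟩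
        ∑[ i < t ] partPrefix i (rank a₀)            ≡⟨ prefix-split (rank a₀) ⟨
        prefix (rank a₀)                             ∎)
        where
        open ≤-Reasoning
        termwise : ∀ i → M * when (before? i (rank a₀)) 1 ≤ partPrefix i (rank a₀)
        termwise i with before? i (rank a₀)
        ... | yes before = ≤-reflexive (trans (*-identityʳ M) (sym (partPrefix-before i (rank a₀) before)))
        ... | no  _      = ≤-trans (≤-reflexive (*-zeroʳ M)) z≤n

      -- A part that is neither before a₀ nor meets the window lies after B:
      -- an edge entering it from before a₀ would reach B, contradicting the
      -- choice of a₀.
      behind-window : ∀ i → ¬ Before i (rank a₀) → ¬ (∃ λ v → v ∈ window × p v ≡ i) →
                      After i (rank B)
      behind-window i ¬before ¬meets with sides i (rank a₀)
      ... | inj₁ before = ⊥-elim (¬before before)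
      ... | inj₂ (inj₁ after) = λ v v∈i → past-window v v∈i (after v v∈i)
        where
        past-window : ∀ v → p v ≡ i → rank a₀ ≤ rank v → rank B ≤ rank v
        past-window v v∈i a₀≤v with rank v ≤? rank B
        ... | yes v≤B = ⊥-elim (¬meets (v , ∈-subsetOf⁺ inWindow? (a₀≤v , v≤B) , v∈i))
        ... | no  v≰B = <⇒≤ (≰⇒> v≰B)
      ... | inj₂ (inj₂ (s , s' , adj , s<a₀ , a₀≤s' , s'∈i)) =
        ⊥-elim (<⇒≱ s<a₀ (a₀-first s s-reaches))
        where
        s<B : rank s < rank B
        s<B = <-≤-trans s<a₀ (proj₁ a₀-reaches)
        B<s' : rank B < rank s'
        B<s' with rank s' ≤? rank B
        ... | yes s'≤B = ⊥-elim (¬meets (s' , ∈-subsetOf⁺ inWindow? (a₀≤s' , s'≤B) , s'∈i))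
        ... | no  s'≰B = ≰⇒> s'≰B
        s~B : Adj _⊏_ G s B
        s~B = umbrella s s B s' ≤-refl (<⇒≤ s<B) (<⇒≤ B<s') (proj₂ (proj₂ adj))
                       (λ s≡B → <-irrefl (cong rank s≡B) s<B)
        s-reaches : Reaches B s
        s-reaches = <⇒≤ s<B , proj₂ (proj₂ s~B)

      counted : Fin t → ℕ
      counted i = when (before? i (rank a₀)) 1 + when (meets? i) 1

      -- Every part contributes at most M * counted i to the prefix at B, and
      -- the part of B, which B itself misses, strictly less.
      prefix-B<[I+D]M : prefix (rank B) < (I + D) * M
      prefix-B<[I+D]M = begin-strict
        prefix (rank B)                   ≡⟨ prefix-split (rank B) ⟩
        ∑[ i < t ] partPrefix i (rank B)  <⟨ sum-mono-< termwise (p B) own-part ⟩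
        ∑[ i < t ] (M * counted i)        ≡⟨ *-distribˡ-sum {t} M counted ⟨
        M * ∑[ i < t ] counted i          ≡⟨ cong (M *_) (∑-distrib-+ (λ i → when (before? i (rank a₀)) 1) _) ⟩
        M * (I + D)                       ≡⟨ *-comm M (I + D) ⟩
        (I + D) * M                       ∎
        where
        open ≤-Reasoning
        M≤M* : ∀ {k} → 1 ≤ k → M ≤ M * k
        M≤M* {k} 1≤k = ≤-trans (≤-reflexive (sym (*-identityʳ M))) (*-monoʳ-≤ M 1≤k)
        termwise : ∀ i → partPrefix i (rank B) ≤ M * counted i
        termwise i with before? i (rank a₀) | meets? i
        ... | yes _      | _         = ≤-trans (partPrefix≤M i (rank B)) (M≤M* (s≤s z≤n))
        ... | no  _      | yes _     = ≤-trans (partPrefix≤M i (rank B)) (M≤M* (s≤s z≤n))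
        ... | no ¬before | no ¬meets =
          ≤-trans (≤-reflexive (partPrefix-after i (rank B) (behind-window i ¬before ¬meets))) z≤n
        B-meets : ∃ λ v → v ∈ window × p v ≡ p B
        B-meets = B , ∈-subsetOf⁺ inWindow? (a₀-first B (≤-refl , valid B) , ≤-refl) , refl
        own-part : partPrefix (p B) (rank B) < M * counted (p B)
        own-part = <-≤-trans (partPrefix-own<M B)
          (M≤M* (≤-trans (≤-reflexive (sym (when-yes (meets? (p B)) B-meets))) (m≤n+m _ _)))

      -- label B < I + D ≤ label a₀ + D, so K meets at most D ≤ λ blocks.
      clique-bound : partsMet _⊏_ G block K ≤ lam
      clique-bound = begin
        partsMet _⊏_ G block K       ≤⟨ blocksMet≤ ⟩
        suc (label B) ∸ label a₀     ≤⟨ m≤n+o⇒m∸n≤o (suc (label B)) (label a₀) label-B<label-a₀+D ⟩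
        D                            ≡⟨ count-as-sum meets? ⟨
        partsMet _⊏_ G p window      ≤⟨ cliques window window-clique ⟩
        lam                          ∎
        where
        open ≤-Reasoning
        label-B<label-a₀+D : label B < label a₀ + D
        label-B<label-a₀+D = <-≤-trans (m<n*o⇒m/o<n prefix-B<[I+D]M) (+-monoˡ-≤ D I≤label-a₀)

    block-cliques : ∀ K → IsClique _⊏_ G K → partsMet _⊏_ G block K ≤ lam
    block-cliques K K-clique with FP.any? (_∈? K)
    ... | no empty = ≤-trans (≤-reflexive (trans (count-as-sum metBy?) (sum-zero λ j →
                       when-no (metBy? j) λ { (v , v∈K , _) → empty (v , v∈K) }))) z≤n
      where
      metBy? : ∀ j → Dec (∃ λ v → v ∈ K × block v ≡ j)
      metBy? j = FP.any? (λ v → (v ∈? K) ×-dec (block v FP.≟ j))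
    ... | yes inhabited with latest (_∈? K) inhabited
    ...   | B , B∈K , B-last with earliest (reaches? B) (B , ≤-refl , valid B)
    ...     | a₀ , a₀-reaches , a₀-first =
      CliqueBound.clique-bound K K-clique B B∈K B-last a₀ a₀-reaches a₀-first

    block-partition : IsPartition _⊏_ G block lam C
    block-partition = record
      { nonempty  = block-surjective
      ; connected = block-connected
      ; bounded   = block-size
      ; cliques   = block-cliques
      }

lemma3 : ∀ {a ℓ : Level} {A : Set a} (_<_ : Rel A ℓ) → IsStrictTotalOrder _≡_ _<_ →
    ∀ (n : ℕ) (G : PIRep _<_ n) (pos : Fin n → Fin n) → CanonicalOrdering _<_ G pos →
    ∀ (lam C : ℕ) → HasPartition _<_ G lam C ⇔ HasBlockPartition _<_ G pos lam C
lemma3 _<_ sto n G pos canonical lam C = mk⇔ round forget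
  where
  round : HasPartition _<_ G lam C → HasBlockPartition _<_ G pos lam C
  round (t , p , p-partition) = t , block , block-partition , blocks
    where open ProperIntervals.Rounding _<_ sto G pos canonical p p-partition

  forget : HasBlockPartition _<_ G pos lam C → HasPartition _<_ G lam C
  forget (t , p , p-partition , _) = t , p , p-partition
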